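{- Let $\lambda\in\mathbf{C}$ with $\lambda\neq 1$ and let $r\in\mathbf{Z}_{+}$. For every $n\in\mathbf{Z}_{+}$, $$H_{n}(x\vert\lambda)=\frac{1}{(1-\lambda)^{r}}\sum_{k=0}^{n}\binom{n}{k}\Bigl(\sum_{j=0}^{r}\binom{r}{j}(-\lambda)^{r-j}H_{n-k}(j\vert\lambda)\Bigr)H_{k}^{(r)}(x\vert\lambda).$$
   Context: For $\lambda\in\mathbf{C}$, $\lambda\neq1$, the Frobenius–Euler polynomials are defined by $\frac{1-\lambda}{e^{t}-\lambda}e^{xt}=\sum_{n=0}^{\infty}H_{n}(x\vert\lambda)\frac{t^{n}}{n!}$, and for $r\in\mathbf{Z}_+$ the Frobenius–Euler polynomials of order $r$ are defined by $\left(\frac{1-\lambda}{e^{t}-\lambda}\right)^{r}e^{xt}=\sum_{n=0}^{\infty}H_{n}^{(r)}(x\vert\lambda)\frac{t^{n}}{n!}$. $\mathbf{Z}_+$ denotes the nonnegative integers. -}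

module Defs where

open import Level using (Level; _⊔_)
open import Data.Nat as ℕ using (ℕ; zero; suc; _∸_)
open import Data.Nat.Combinatorics using (_C_)
open import Data.Product using (Σ)
open import Relation.Nullary using (¬_)
open import Algebra.Bundles using (CommutativeRing)

record Field (c ℓ : Level) : Set (Level.suc (c ⊔ ℓ)) where
  field
    commutativeRing : CommutativeRing c ℓ
  open CommutativeRing commutativeRing public
  field
    0≉1     : ¬ (0# ≈ 1#)
    inverse : ∀ x → ¬ (x ≈ 0#) → Σ Carrier (λ y → x * y ≈ 1#)

module FE {c ℓ : Level} (F : Field c ℓ) where
  open Field F

  nat : ℕ → Carrier
  nat zero    = 0#
  nat (suc n) = 1# + nat n

  _^_ : Carrier → ℕ → Carrier
  x ^ zero  = 1#
  x ^ suc n = x * (x ^ n)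

  sumTo : ℕ → (ℕ → Carrier) → Carrier
  sumTo zero    f = f 0
  sumTo (suc n) f = sumTo n f + f (suc n)

  -- Exponential generating functions Σ a n t^n/n!, represented by their
  -- coefficient sequences a : ℕ → Carrier.
  EGF : Set c
  EGF = ℕ → Carrier

  -- product of exponential generating functions (binomial convolution):
  -- (Σ a n t^n/n!)(Σ b n t^n/n!) = Σ (Σ_k C(n,k) a_k b_{n-k}) t^n/n!
  _⊛_ : EGF → EGF → EGF
  (a ⊛ b) n = sumTo n (λ k → nat (n C k) * (a k * b (n ∸ k)))

  _⊝_ : EGF → EGF → EGF
  (a ⊝ b) n = a n - b n

  const : Carrier → EGF
  const x zero    = x
  const x (suc n) = 0#

  oneE : EGF
  oneE = const 1#

  -- e^{xt} = Σ x^n t^n/n!   (so e^t = expX 1#)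
  expX : Carrier → EGF
  expX x n = x ^ n

  scale : Carrier → EGF → EGF
  scale x a n = x * a n

  powE : EGF → ℕ → EGF
  powE a zero    = oneE
  powE a (suc r) = a ⊛ powE a r

  -- H : ℕ → Carrier → Carrier, H n x = H_n(x|λ), is the Frobenius–Euler
  -- polynomial family: Σ H_n(x|λ) t^n/n! = (1-λ)/(e^t-λ) · e^{xt},
  -- i.e. (e^t - λ) · Σ H_n(x|λ) t^n/n! = (1-λ) e^{xt}  (e^t - λ is invertible since 1-λ ≠ 0).
  IsFrobeniusEuler : Carrier → (ℕ → Carrier → Carrier) → Set (c ⊔ ℓ)
  IsFrobeniusEuler lam H =
    ∀ (x : Carrier) (n : ℕ) →
      ((expX 1# ⊝ const lam) ⊛ (λ m → H m x)) n ≈ scale (1# - lam) (expX x) n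

  -- Hr : ℕ → ℕ → Carrier → Carrier, Hr r n x = H_n^{(r)}(x|λ):
  -- Σ H_n^{(r)}(x|λ) t^n/n! = ((1-λ)/(e^t-λ))^r e^{xt},
  -- i.e. (e^t - λ)^r · Σ H_n^{(r)}(x|λ) t^n/n! = (1-λ)^r e^{xt}.
  IsFrobeniusEulerOrder : Carrier → (ℕ → ℕ → Carrier → Carrier) → Set (c ⊔ ℓ)
  IsFrobeniusEulerOrder lam Hr =
    ∀ (r : ℕ) (x : Carrier) (n : ℕ) →
      (powE (expX 1# ⊝ const lam) r ⊛ (λ m → Hr r m x)) n
        ≈ scale ((1# - lam) ^ r) (expX x) n

-- Work with exponential generating functions under the binomial convolution ⊛, writing
-- h_y = Σ H_n(y|λ) tⁿ/n! and E = e^t − λ, so that E·h_y = (1 − λ)·e^{yt}. The constant term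
-- 1 − λ of E is invertible, so E can be cancelled; this gives h_y = h_0·e^{yt}, hence
-- e^t·h_y = h_{y+1} and E·h_y = h_{y+1} − λ·h_y. Iterating the last identity (through the
-- Leibniz rule in the variable r) shows that the inner sum over j is the coefficient sequence
-- of E^r·h_0. The outer sum is then the coefficient of h^{(r)}_x·E^r·h_0 = (1 − λ)^r·e^{xt}·h_0
-- = (1 − λ)^r·h_x.
module Submission where

open import Level using (Level)
open import Data.Nat as ℕ using (ℕ; zero; suc; _∸_; _≤_; _<_; z≤n; s≤s)
import Data.Nat.Properties as ℕ
open import Data.Nat.Combinatorics using (_C_; nCn≡1; nCk+nC[k+1]≡[n+1]C[k+1]; k>n⇒nCk≡0)
open import Data.Sum using (inj₁; inj₂)
open import Relation.Binary.Bundles using (Setoid)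
import Relation.Binary.PropositionalEquality as ≡
open import Relation.Nullary using (¬_)
import Relation.Binary.Reasoning.Setoid as SetoidReasoning
import Algebra.Properties.CommutativeSemigroup as CommutativeSemigroupProperties
import Algebra.Properties.Group as GroupProperties
import Algebra.Properties.Ring as RingProperties
open import Defs

module ConvolutionAlgebra {c ℓ : Level} (F : Field c ℓ) where
  open Field F
  open FE F
  private
    module +CS = CommutativeSemigroupProperties +-commutativeSemigroup
    module *CS = CommutativeSemigroupProperties *-commutativeSemigroup
  open SetoidReasoning setoid
  open GroupProperties +-group using (x∙y⁻¹≈ε⇒x≈y)
  open RingProperties ring using (-1*x≈-x)

  sumTo-cong-≤ : ∀ n {f g : ℕ → Carrier} → (∀ k → k ≤ n → f k ≈ g k) → sumTo n f ≈ sumTo n g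
  sumTo-cong-≤ zero    f≈g = f≈g 0 z≤n
  sumTo-cong-≤ (suc n) f≈g =
    +-cong (sumTo-cong-≤ n (λ k k≤n → f≈g k (ℕ.m≤n⇒m≤1+n k≤n))) (f≈g (suc n) ℕ.≤-refl)

  sumTo-cong : ∀ n {f g : ℕ → Carrier} → (∀ k → f k ≈ g k) → sumTo n f ≈ sumTo n g
  sumTo-cong n f≈g = sumTo-cong-≤ n (λ k _ → f≈g k)

  sumTo-zero : ∀ n (f : ℕ → Carrier) → (∀ k → k ≤ n → f k ≈ 0#) → sumTo n f ≈ 0#
  sumTo-zero n f f≈0 = trans (sumTo-cong-≤ n f≈0) (sumTo-const-0 n)
    where
    sumTo-const-0 : ∀ n → sumTo n (λ _ → 0#) ≈ 0#
    sumTo-const-0 zero    = refl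
    sumTo-const-0 (suc n) = trans (+-cong (sumTo-const-0 n) refl) (+-identityˡ 0#)

  sumTo-distrib-+ : ∀ n (f g : ℕ → Carrier) → sumTo n (λ k → f k + g k) ≈ sumTo n f + sumTo n g
  sumTo-distrib-+ zero    f g = refl
  sumTo-distrib-+ (suc n) f g = trans (+-cong (sumTo-distrib-+ n f g) refl) (+CS.interchange _ _ _ _)

  *-distribˡ-sumTo : ∀ n x (f : ℕ → Carrier) → x * sumTo n f ≈ sumTo n (λ k → x * f k)
  *-distribˡ-sumTo zero    x f = refl
  *-distribˡ-sumTo (suc n) x f = trans (distribˡ x _ _) (+-cong (*-distribˡ-sumTo n x f) refl)

  sumTo-suc : ∀ n (f : ℕ → Carrier) → sumTo (suc n) f ≈ f 0 + sumTo n (λ k → f (suc k))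
  sumTo-suc zero    f = refl
  sumTo-suc (suc n) f = trans (+-cong (sumTo-suc n f) refl) (+-assoc _ _ _)

  sumTo-comm : ∀ n m (f : ℕ → ℕ → Carrier) →
    sumTo n (λ k → sumTo m (λ j → f k j)) ≈ sumTo m (λ j → sumTo n (λ k → f k j))
  sumTo-comm zero    m f = refl
  sumTo-comm (suc n) m f = trans (+-cong (sumTo-comm n m f) refl) (sym (sumTo-distrib-+ m _ _))

  nat-+ : ∀ m n → nat (m ℕ.+ n) ≈ nat m + nat n
  nat-+ zero    n = sym (+-identityˡ _)
  nat-+ (suc m) n = trans (+-cong refl (nat-+ m n)) (sym (+-assoc _ _ _))

  nat-1 : nat 1 ≈ 1#
  nat-1 = +-identityʳ 1#

  nat-pascal : ∀ n k x → nat (suc n C suc k) * x ≈ nat (n C k) * x + nat (n C suc k) * x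
  nat-pascal n k x = begin
    nat (suc n C suc k) * x                ≡⟨ ≡.cong (λ m → nat m * x) (≡.sym (nCk+nC[k+1]≡[n+1]C[k+1] n k)) ⟩
    nat (n C k ℕ.+ n C suc k) * x          ≈⟨ *-cong (nat-+ (n C k) (n C suc k)) refl ⟩
    (nat (n C k) + nat (n C suc k)) * x    ≈⟨ distribʳ x _ _ ⟩
    nat (n C k) * x + nat (n C suc k) * x  ∎

  nat-nC[1+n] : ∀ n x → nat (n C suc n) * x ≈ 0#
  nat-nC[1+n] n x rewrite k>n⇒nCk≡0 (ℕ.n<1+n n) = zeroˡ x

  infix 4 _≐_
  _≐_ : EGF → EGF → Set ℓ
  a ≐ b = ∀ n → a n ≈ b n

  ≐-setoid : Setoid c ℓ
  ≐-setoid = record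
    { Carrier       = EGF
    ; _≈_           = _≐_
    ; isEquivalence = record
      { refl  = λ _ → refl
      ; sym   = λ a≐b n → sym (a≐b n)
      ; trans = λ a≐b b≐d n → trans (a≐b n) (b≐d n)
      }
    }

  open Setoid ≐-setoid public using () renaming (sym to ≐-sym)

  module ≐-Reasoning = SetoidReasoning ≐-setoid

  infixl 6 _⊕_
  _⊕_ : EGF → EGF → EGF
  (a ⊕ b) n = a n + b n

  -- the formal derivative of Σ a n t^n/n!
  ∂ : EGF → EGF
  ∂ a n = a (suc n)

  scale-congʳ : ∀ x {a b} → a ≐ b → scale x a ≐ scale x b
  scale-congʳ x a≐b n = *-cong refl (a≐b n)

  ⊛-congˡ : ∀ {a a′} → a ≐ a′ → ∀ b → a ⊛ b ≐ a′ ⊛ b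
  ⊛-congˡ a≐a′ b n = sumTo-cong n (λ k → *-cong refl (*-cong (a≐a′ k) refl))

  ⊛-congʳ : ∀ a {b b′} → b ≐ b′ → a ⊛ b ≐ a ⊛ b′
  ⊛-congʳ a b≐b′ n = sumTo-cong n (λ k → *-cong refl (*-cong refl (b≐b′ (n ∸ k))))

  ⊛-coeff₀ : ∀ a b → (a ⊛ b) 0 ≈ a 0 * b 0
  ⊛-coeff₀ a b = trans (*-cong nat-1 refl) (*-identityˡ _)

  ⊛-leibniz : ∀ a b → ∂ (a ⊛ b) ≐ (∂ a ⊛ b) ⊕ (a ⊛ ∂ b)
  ⊛-leibniz a b n = begin
    (a ⊛ b) (suc n)                              ≈⟨ sumTo-suc n g ⟩
    g 0 + sumTo n (λ k → g (suc k))              ≈⟨ +-cong refl (sumTo-cong n (λ k → nat-pascal n k _)) ⟩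
    g 0 + sumTo n (λ k → X k + Y k)              ≈⟨ +-cong refl (sumTo-distrib-+ n X Y) ⟩
    g 0 + (sumTo n X + sumTo n Y)                ≈⟨ +CS.x∙yz≈y∙xz _ _ _ ⟩
    sumTo n X + (g 0 + sumTo n Y)                ≈⟨ +-cong refl (sym (sumTo-suc n h)) ⟩
    sumTo n X + (sumTo n h + h (suc n))          ≈⟨ +-cong refl (+-cong refl (nat-nC[1+n] n _)) ⟩
    sumTo n X + (sumTo n h + 0#)                 ≈⟨ +-cong refl (+-identityʳ _) ⟩
    sumTo n X + sumTo n h                        ≈⟨ +-cong refl (sumTo-cong-≤ n b-index) ⟩
    (∂ a ⊛ b) n + (a ⊛ ∂ b) n                    ∎
    where
    g = λ k → nat (suc n C k) * (a k * b (suc n ∸ k))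
    h = λ k → nat (n C k) * (a k * b (suc n ∸ k))
    X = λ k → nat (n C k) * (a (suc k) * b (n ∸ k))
    Y = λ k → nat (n C suc k) * (a (suc k) * b (n ∸ k))
    b-index : ∀ k → k ≤ n → h k ≈ nat (n C k) * (a k * ∂ b (n ∸ k))
    b-index k k≤n rewrite ℕ.+-∸-assoc 1 k≤n = refl

  ⊛-distribʳ-⊕ : ∀ a b d → (a ⊕ b) ⊛ d ≐ (a ⊛ d) ⊕ (b ⊛ d)
  ⊛-distribʳ-⊕ a b d n =
    trans (sumTo-cong n (λ k → trans (*-cong refl (distribʳ _ _ _)) (distribˡ _ _ _))) (sumTo-distrib-+ n _ _)

  ⊛-distribˡ-⊕ : ∀ a b d → a ⊛ (b ⊕ d) ≐ (a ⊛ b) ⊕ (a ⊛ d)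
  ⊛-distribˡ-⊕ a b d n =
    trans (sumTo-cong n (λ k → trans (*-cong refl (distribˡ _ _ _)) (distribˡ _ _ _))) (sumTo-distrib-+ n _ _)

  ⊛-scaleˡ : ∀ x a b → scale x a ⊛ b ≐ scale x (a ⊛ b)
  ⊛-scaleˡ x a b n =
    trans (sumTo-cong n (λ k → trans (*-cong refl (*-assoc _ _ _)) (*CS.x∙yz≈y∙xz _ _ _))) (sym (*-distribˡ-sumTo n x _))

  ⊛-scaleʳ : ∀ x a b → a ⊛ scale x b ≐ scale x (a ⊛ b)
  ⊛-scaleʳ x a b n =
    trans (sumTo-cong n (λ k → trans (*-cong refl (*CS.x∙yz≈y∙xz _ _ _)) (*CS.x∙yz≈y∙xz _ _ _))) (sym (*-distribˡ-sumTo n x _))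

  ⊛-sumʳ : ∀ a r (u : ℕ → EGF) → a ⊛ (λ m → sumTo r (λ j → u j m)) ≐ (λ m → sumTo r (λ j → (a ⊛ u j) m))
  ⊛-sumʳ a r u n =
    trans (sumTo-cong n (λ k → trans (*-cong refl (*-distribˡ-sumTo r (a k) _)) (*-distribˡ-sumTo r _ _))) (sumTo-comm n r _)

  ⊛-comm : ∀ a b → a ⊛ b ≐ b ⊛ a
  ⊛-comm a b zero    = *-cong refl (*-comm _ _)
  ⊛-comm a b (suc n) = begin
    (a ⊛ b) (suc n)              ≈⟨ ⊛-leibniz a b n ⟩
    (∂ a ⊛ b) n + (a ⊛ ∂ b) n    ≈⟨ +-cong (⊛-comm (∂ a) b n) (⊛-comm a (∂ b) n) ⟩
    (b ⊛ ∂ a) n + (∂ b ⊛ a) n    ≈⟨ +-comm _ _ ⟩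
    (∂ b ⊛ a) n + (b ⊛ ∂ a) n    ≈⟨ sym (⊛-leibniz b a n) ⟩
    (b ⊛ a) (suc n)              ∎

  ⊛-identityˡ : ∀ a → oneE ⊛ a ≐ a
  ⊛-identityˡ a zero    = trans (⊛-coeff₀ oneE a) (*-identityˡ _)
  ⊛-identityˡ a (suc n) = begin
    (oneE ⊛ a) (suc n)                ≈⟨ ⊛-leibniz oneE a n ⟩
    (∂ oneE ⊛ a) n + (oneE ⊛ ∂ a) n   ≈⟨ +-cong ∂oneE⊛a≈0 (⊛-identityˡ (∂ a) n) ⟩
    0# + a (suc n)                    ≈⟨ +-identityˡ _ ⟩
    a (suc n)                         ∎
    where
    ∂oneE⊛a≈0 : (∂ oneE ⊛ a) n ≈ 0#
    ∂oneE⊛a≈0 = sumTo-zero n _ (λ k _ → trans (*-cong refl (zeroˡ _)) (zeroʳ _))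

  ⊛-assoc : ∀ a b d → (a ⊛ b) ⊛ d ≐ a ⊛ (b ⊛ d)
  ⊛-assoc a b d zero = begin
    ((a ⊛ b) ⊛ d) 0        ≈⟨ ⊛-coeff₀ (a ⊛ b) d ⟩
    (a ⊛ b) 0 * d 0        ≈⟨ *-cong (⊛-coeff₀ a b) refl ⟩
    (a 0 * b 0) * d 0      ≈⟨ *-assoc _ _ _ ⟩
    a 0 * (b 0 * d 0)      ≈⟨ *-cong refl (sym (⊛-coeff₀ b d)) ⟩
    a 0 * (b ⊛ d) 0        ≈⟨ sym (⊛-coeff₀ a (b ⊛ d)) ⟩
    (a ⊛ (b ⊛ d)) 0        ∎
  ⊛-assoc a b d (suc n) = begin
    ((a ⊛ b) ⊛ d) (suc n)
      ≈⟨ ⊛-leibniz (a ⊛ b) d n ⟩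
    (∂ (a ⊛ b) ⊛ d) n + ((a ⊛ b) ⊛ ∂ d) n
      ≈⟨ +-cong (⊛-congˡ (⊛-leibniz a b) d n) refl ⟩
    (((∂ a ⊛ b) ⊕ (a ⊛ ∂ b)) ⊛ d) n + ((a ⊛ b) ⊛ ∂ d) n
      ≈⟨ +-cong (⊛-distribʳ-⊕ (∂ a ⊛ b) (a ⊛ ∂ b) d n) refl ⟩
    (((∂ a ⊛ b) ⊛ d) n + ((a ⊛ ∂ b) ⊛ d) n) + ((a ⊛ b) ⊛ ∂ d) n
      ≈⟨ +-cong (+-cong (⊛-assoc (∂ a) b d n) (⊛-assoc a (∂ b) d n)) (⊛-assoc a b (∂ d) n) ⟩
    ((∂ a ⊛ (b ⊛ d)) n + (a ⊛ (∂ b ⊛ d)) n) + (a ⊛ (b ⊛ ∂ d)) n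
      ≈⟨ +-assoc _ _ _ ⟩
    (∂ a ⊛ (b ⊛ d)) n + ((a ⊛ (∂ b ⊛ d)) n + (a ⊛ (b ⊛ ∂ d)) n)
      ≈⟨ +-cong refl (sym (⊛-distribˡ-⊕ a (∂ b ⊛ d) (b ⊛ ∂ d) n)) ⟩
    (∂ a ⊛ (b ⊛ d)) n + (a ⊛ ((∂ b ⊛ d) ⊕ (b ⊛ ∂ d))) n
      ≈⟨ +-cong refl (⊛-congʳ a (≐-sym (⊛-leibniz b d)) n) ⟩
    (∂ a ⊛ (b ⊛ d)) n + (a ⊛ ∂ (b ⊛ d)) n
      ≈⟨ sym (⊛-leibniz a (b ⊛ d) n) ⟩
    (a ⊛ (b ⊛ d)) (suc n)
      ∎

  const-⊛ : ∀ x a → const x ⊛ a ≐ scale x a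
  const-⊛ x a n =
    trans (⊛-congˡ const≐scale a n) (trans (⊛-scaleˡ x oneE a n) (*-cong refl (⊛-identityˡ a n)))
    where
    const≐scale : const x ≐ scale x oneE
    const≐scale zero    = sym (*-identityʳ x)
    const≐scale (suc n) = sym (zeroʳ x)

  ⊛-⊝ˡ : ∀ a b d → (a ⊝ b) ⊛ d ≐ (a ⊛ d) ⊝ (b ⊛ d)
  ⊛-⊝ˡ a b d n = begin
    ((a ⊝ b) ⊛ d) n                        ≈⟨ ⊛-congˡ (λ k → +-cong refl (sym (-1*x≈-x _))) d n ⟩
    ((a ⊕ scale (- 1#) b) ⊛ d) n           ≈⟨ ⊛-distribʳ-⊕ a (scale (- 1#) b) d n ⟩
    (a ⊛ d) n + (scale (- 1#) b ⊛ d) n     ≈⟨ +-cong refl (trans (⊛-scaleˡ (- 1#) b d n) (-1*x≈-x _)) ⟩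
    (a ⊛ d) n - (b ⊛ d) n                  ∎

  expX-+ : ∀ x y → expX x ⊛ expX y ≐ expX (x + y)
  expX-+ x y zero    = trans (⊛-coeff₀ (expX x) (expX y)) (*-identityˡ _)
  expX-+ x y (suc n) = begin
    (expX x ⊛ expX y) (suc n)                                ≈⟨ ⊛-leibniz (expX x) (expX y) n ⟩
    (scale x (expX x) ⊛ expX y) n + (expX x ⊛ scale y (expX y)) n
                                                             ≈⟨ +-cong (⊛-scaleˡ x (expX x) (expX y) n) (⊛-scaleʳ y (expX x) (expX y) n) ⟩
    x * (expX x ⊛ expX y) n + y * (expX x ⊛ expX y) n        ≈⟨ sym (distribʳ _ _ _) ⟩
    (x + y) * (expX x ⊛ expX y) n                            ≈⟨ *-cong refl (expX-+ x y n) ⟩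
    (x + y) ^ suc n                                          ∎

  expX-0 : expX 0# ≐ oneE
  expX-0 zero    = refl
  expX-0 (suc n) = zeroˡ _

  module Cancellation (a : EGF) (a₀⁻¹ : Carrier) (a₀a₀⁻¹≈1 : a 0 * a₀⁻¹ ≈ 1#) where

    ⊛-lastTerm : ∀ w n → (∀ k → k < n → w k ≈ 0#) → (w ⊛ a) n ≈ w n * a 0
    ⊛-lastTerm w zero    _   = ⊛-coeff₀ w a
    ⊛-lastTerm w (suc m) w≈0 = begin
      sumTo m _ + nat (suc m C suc m) * (w (suc m) * a (suc m ∸ suc m))
        ≈⟨ +-cong (sumTo-zero m _ (λ k k≤m → trans (*-cong refl (trans (*-cong (w≈0 k (s≤s k≤m)) refl) (zeroˡ _))) (zeroʳ _))) refl ⟩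
      0# + nat (suc m C suc m) * (w (suc m) * a (suc m ∸ suc m))
        ≈⟨ +-identityˡ _ ⟩
      nat (suc m C suc m) * (w (suc m) * a (suc m ∸ suc m))
        ≡⟨ ≡.cong₂ (λ i j → nat i * (w (suc m) * a j)) (nCn≡1 (suc m)) (ℕ.n∸n≡0 m) ⟩
      nat 1 * (w (suc m) * a 0)
        ≈⟨ trans (*-cong nat-1 refl) (*-identityˡ _) ⟩
      w (suc m) * a 0
        ∎

    y*a₀≈0⇒y≈0 : ∀ y → y * a 0 ≈ 0# → y ≈ 0#
    y*a₀≈0⇒y≈0 y ya₀≈0 = begin
      y                     ≈⟨ sym (*-identityʳ y) ⟩
      y * 1#                ≈⟨ *-cong refl (sym a₀a₀⁻¹≈1) ⟩
      y * (a 0 * a₀⁻¹)      ≈⟨ sym (*-assoc _ _ _) ⟩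
      (y * a 0) * a₀⁻¹      ≈⟨ *-cong ya₀≈0 refl ⟩
      0# * a₀⁻¹             ≈⟨ zeroˡ a₀⁻¹ ⟩
      0#                    ∎

    ⊛a≈0⇒≈0 : ∀ w → (∀ n → (w ⊛ a) n ≈ 0#) → ∀ n → w n ≈ 0#
    ⊛a≈0⇒≈0 w w⊛a≈0 n = vanishes-below (suc n) n ℕ.≤-refl
      where
      vanishes-below : ∀ m k → k < m → w k ≈ 0#
      vanishes-below (suc m) k (s≤s k≤m) with ℕ.m≤n⇒m<n∨m≡n k≤m
      ... | inj₁ k<m    = vanishes-below m k k<m
      ... | inj₂ ≡.refl = y*a₀≈0⇒y≈0 (w k) (trans (sym (⊛-lastTerm w k (vanishes-below k))) (w⊛a≈0 k))

    ⊛-cancelˡ : ∀ u v → a ⊛ u ≐ a ⊛ v → u ≐ v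
    ⊛-cancelˡ u v a⊛u≐a⊛v n =
      x∙y⁻¹≈ε⇒x≈y _ _ (⊛a≈0⇒≈0 (u ⊝ v) [u-v]⊛a≈0 n)
      where
      [u-v]⊛a≈0 : ∀ m → ((u ⊝ v) ⊛ a) m ≈ 0#
      [u-v]⊛a≈0 m = begin
        ((u ⊝ v) ⊛ a) m             ≈⟨ ⊛-⊝ˡ u v a m ⟩
        (u ⊛ a) m - (v ⊛ a) m       ≈⟨ +-cong (⊛-comm u a m) (-‿cong (⊛-comm v a m)) ⟩
        (a ⊛ u) m - (a ⊛ v) m       ≈⟨ +-cong (a⊛u≐a⊛v m) refl ⟩
        (a ⊛ v) m - (a ⊛ v) m       ≈⟨ -‿inverseʳ _ ⟩
        0#                          ∎

  ^-inverse : ∀ {x y} → x * y ≈ 1# → ∀ r → y ^ r * x ^ r ≈ 1#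
  ^-inverse xy≈1 zero    = *-identityˡ 1#
  ^-inverse {x} {y} xy≈1 (suc r) = begin
    (y * y ^ r) * (x * x ^ r)    ≈⟨ *CS.interchange _ _ _ _ ⟩
    (y * x) * (y ^ r * x ^ r)    ≈⟨ *-cong (trans (*-comm y x) xy≈1) (^-inverse xy≈1 r) ⟩
    1# * 1#                      ≈⟨ *-identityˡ 1# ⟩
    1#                           ∎

module FrobeniusEulerPolynomials {c ℓ : Level} (F : Field c ℓ) (lam inv : Field.Carrier F) where
  open Field F
  open FE F
  open ConvolutionAlgebra F
  open RingProperties ring using (-‿distribˡ-*)

  E : EGF
  E = expX 1# ⊝ const lam

  module _ (inv-correct : (1# - lam) * inv ≈ 1#)
           (H : ℕ → Carrier → Carrier) (isFE : IsFrobeniusEuler lam H) where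

    h : Carrier → EGF
    h y m = H m y

    -- Δ r m = (Δ_λ^r H_m)(0), where (Δ_λ f)(y) = f(y + 1) − λ f(y)
    Δ : ℕ → EGF
    Δ r m = sumTo r (λ j → nat (r C j) * (((- lam) ^ (r ∸ j)) * H m (nat j)))

    open Cancellation E inv inv-correct using (⊛-cancelˡ)

    h-translate : ∀ y → h 0# ⊛ expX y ≐ h y
    h-translate y = ⊛-cancelˡ _ _ (begin
      E ⊛ (h 0# ⊛ expX y)                  ≈⟨ ≐-sym (⊛-assoc E (h 0#) (expX y)) ⟩
      (E ⊛ h 0#) ⊛ expX y                  ≈⟨ ⊛-congˡ (isFE 0#) (expX y) ⟩
      scale (1# - lam) (expX 0#) ⊛ expX y  ≈⟨ ⊛-scaleˡ (1# - lam) (expX 0#) (expX y) ⟩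
      scale (1# - lam) (expX 0# ⊛ expX y)  ≈⟨ scale-congʳ (1# - lam) (⊛-congˡ expX-0 (expX y)) ⟩
      scale (1# - lam) (oneE ⊛ expX y)     ≈⟨ scale-congʳ (1# - lam) (⊛-identityˡ (expX y)) ⟩
      scale (1# - lam) (expX y)            ≈⟨ ≐-sym (isFE y) ⟩
      E ⊛ h y                              ∎)
      where open ≐-Reasoning

    expX1⊛h : ∀ y → expX 1# ⊛ h y ≐ h (1# + y)
    expX1⊛h y = begin
      expX 1# ⊛ h y                ≈⟨ ⊛-congʳ (expX 1#) (≐-sym (h-translate y)) ⟩
      expX 1# ⊛ (h 0# ⊛ expX y)    ≈⟨ ⊛-congʳ (expX 1#) (⊛-comm (h 0#) (expX y)) ⟩
      expX 1# ⊛ (expX y ⊛ h 0#)    ≈⟨ ≐-sym (⊛-assoc (expX 1#) (expX y) (h 0#)) ⟩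
      (expX 1# ⊛ expX y) ⊛ h 0#    ≈⟨ ⊛-congˡ (expX-+ 1# y) (h 0#) ⟩
      expX (1# + y) ⊛ h 0#         ≈⟨ ⊛-comm (expX (1# + y)) (h 0#) ⟩
      h 0# ⊛ expX (1# + y)         ≈⟨ h-translate (1# + y) ⟩
      h (1# + y)                   ∎
      where open ≐-Reasoning

    E⊛h : ∀ y → E ⊛ h y ≐ h (1# + y) ⊝ scale lam (h y)
    E⊛h y n = trans (⊛-⊝ˡ (expX 1#) (const lam) (h y) n) (+-cong (expX1⊛h y n) (-‿cong (const-⊛ lam (h y) n)))

    -- In the variable r, Δ r m is the binomial convolution of j ↦ H m j with e^{−λt}.
    Δ-suc : ∀ r → Δ (suc r) ≐ E ⊛ Δ r
    Δ-suc r m = begin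
      Δ (suc r) m                                     ≈⟨ sumTo-cong (suc r) (λ j → *-cong refl (*-comm _ _)) ⟩
      (φ ⊛ Q) (suc r)                                 ≈⟨ ⊛-leibniz φ Q r ⟩
      (∂ φ ⊛ Q) r + (φ ⊛ scale (- lam) Q) r           ≈⟨ +-cong refl (trans (⊛-scaleʳ (- lam) φ Q r) (sym (⊛-scaleˡ (- lam) φ Q r))) ⟩
      (∂ φ ⊛ Q) r + (scale (- lam) φ ⊛ Q) r           ≈⟨ sym (⊛-distribʳ-⊕ (∂ φ) (scale (- lam) φ) Q r) ⟩
      ((∂ φ ⊕ scale (- lam) φ) ⊛ Q) r                 ≈⟨ ⊛-congˡ ∂φ-λφ≐ψ Q r ⟩
      (ψ ⊛ Q) r                                       ≈⟨ sumTo-cong r (λ j → trans (*CS.x∙yz≈xz∙y _ _ _) (sym (⊛-scaleʳ _ E (h (nat j)) m))) ⟩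
      sumTo r (λ j → (E ⊛ u j) m)                     ≈⟨ sym (⊛-sumʳ E r u m) ⟩
      (E ⊛ (λ m′ → sumTo r (λ j → u j m′))) m         ≈⟨ ⊛-congʳ E (λ m′ → sumTo-cong r (λ j → *-assoc (nat (r C j)) ((- lam) ^ (r ∸ j)) (H m′ (nat j)))) m ⟩
      (E ⊛ Δ r) m                                     ∎
      where
      open SetoidReasoning setoid
      module *CS = CommutativeSemigroupProperties *-commutativeSemigroup
      φ Q ψ : EGF
      φ j = H m (nat j)
      Q   = expX (- lam)
      ψ j = (E ⊛ h (nat j)) m
      u : ℕ → EGF
      u j = scale (nat (r C j) * (- lam) ^ (r ∸ j)) (h (nat j))
      ∂φ-λφ≐ψ : ∂ φ ⊕ scale (- lam) φ ≐ ψ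
      ∂φ-λφ≐ψ j = trans (+-cong refl (sym (-‿distribˡ-* lam (φ j)))) (sym (E⊛h (nat j) m))

    Δ≐powE⊛h₀ : ∀ r → Δ r ≐ powE E r ⊛ h 0#
    Δ≐powE⊛h₀ zero m =
      trans (trans (*-cong nat-1 refl) (trans (*-identityˡ _) (*-identityˡ _))) (sym (⊛-identityˡ (h 0#) m))
    Δ≐powE⊛h₀ (suc r) = begin
      Δ (suc r)                   ≈⟨ Δ-suc r ⟩
      E ⊛ Δ r                     ≈⟨ ⊛-congʳ E (Δ≐powE⊛h₀ r) ⟩
      E ⊛ (powE E r ⊛ h 0#)       ≈⟨ ≐-sym (⊛-assoc E (powE E r) (h 0#)) ⟩
      powE E (suc r) ⊛ h 0#       ∎
      where open ≐-Reasoning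

    Δ⊛Hr : (Hr : ℕ → ℕ → Carrier → Carrier) → IsFrobeniusEulerOrder lam Hr → ∀ r x →
      (λ n → sumTo n (λ k → nat (n C k) * (Δ r (n ∸ k) * Hr r k x))) ≐ scale ((1# - lam) ^ r) (h x)
    Δ⊛Hr Hr isFEr r x = begin
      (λ n → sumTo n (λ k → nat (n C k) * (Δ r (n ∸ k) * hr k)))
                                              ≈⟨ (λ n → sumTo-cong n (λ k → *-cong refl (*-comm _ _))) ⟩
      hr ⊛ Δ r                                ≈⟨ ⊛-congʳ hr (Δ≐powE⊛h₀ r) ⟩
      hr ⊛ (powE E r ⊛ h 0#)                  ≈⟨ ≐-sym (⊛-assoc hr (powE E r) (h 0#)) ⟩
      (hr ⊛ powE E r) ⊛ h 0#                  ≈⟨ ⊛-congˡ (⊛-comm hr (powE E r)) (h 0#) ⟩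
      (powE E r ⊛ hr) ⊛ h 0#                  ≈⟨ ⊛-congˡ (isFEr r x) (h 0#) ⟩
      scale ((1# - lam) ^ r) (expX x) ⊛ h 0#  ≈⟨ ⊛-scaleˡ ((1# - lam) ^ r) (expX x) (h 0#) ⟩
      scale ((1# - lam) ^ r) (expX x ⊛ h 0#)  ≈⟨ scale-congʳ ((1# - lam) ^ r) (⊛-comm (expX x) (h 0#)) ⟩
      scale ((1# - lam) ^ r) (h 0# ⊛ expX x)  ≈⟨ scale-congʳ ((1# - lam) ^ r) (h-translate x) ⟩
      scale ((1# - lam) ^ r) (h x)            ∎
      where
      open ≐-Reasoning
      hr : EGF
      hr k = Hr r k x

theorem6 : ∀ {c ℓ : Level} (F : Field c ℓ) → let open Field F in let open FE F in
    (lam : Carrier) → ¬ (lam ≈ 1#) →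
    (inv : Carrier) → (1# - lam) * inv ≈ 1# →
    (H : ℕ → Carrier → Carrier) → IsFrobeniusEuler lam H →
    (Hr : ℕ → ℕ → Carrier → Carrier) → IsFrobeniusEulerOrder lam Hr →
    (r n : ℕ) (x : Carrier) →
      H n x ≈ (inv ^ r) * sumTo n (λ k → nat (n C k)
                 * (sumTo r (λ j → nat (r C j) * (((- lam) ^ (r ∸ j)) * H (n ∸ k) (nat j)))
                    * Hr r k x))
-- λ ≠ 1 enters only through the inverse inv of 1 − λ.
theorem6 F lam _ inv inv-correct H isFE Hr isFEr r n x = begin
  H n x                                  ≈⟨ sym (*-identityˡ _) ⟩
  1# * H n x                             ≈⟨ *-cong (sym (^-inverse inv-correct r)) refl ⟩
  (inv ^ r * (1# - lam) ^ r) * H n x     ≈⟨ *-assoc _ _ _ ⟩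
  inv ^ r * ((1# - lam) ^ r * H n x)     ≈⟨ *-cong refl (sym (Δ⊛Hr inv-correct H isFE Hr isFEr r x n)) ⟩
  inv ^ r * _                            ∎
  where
  open Field F
  open FE F
  open ConvolutionAlgebra F
  open FrobeniusEulerPolynomials F lam inv
  open SetoidReasoning setoid
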